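{- For all $n\ge0$, $U_{n,1}=F_{n+1}$, where $(F_m)_{m\ge0}$ are the Fine numbers.
   Context: $U_{n,1}$ is the number of ascending (weakly increasing) $1$-Naples parking functions of length $n$ whose first entry is $1$, with the convention $U_{0,1}=0$. Parking rules: $n$ spots $1,\dots,n$; cars $c_1,\dots,c_n$ arrive in order with preferences $a_j\in[n]$; $1$-Naples rule: $c_j$ parks at $a_j$ if empty, otherwise parks at $a_j-1$ if that spot exists and is empty, otherwise drives forward from $a_j$ and parks in the first empty spot after $a_j$ (failing if none); a $1$-Naples parking function is a preference for which all cars park. The Fine numbers $F_m$ are defined by $\sum_{m\ge0}F_mx^m=\frac{1}{1-x^2C(x)^2}$, where $C(x)=\sum_{m\ge0}C_mx^m$ is the generating function of the Catalan numbers $C_m=\frac1{m+1}\binom{2m}{m}$ (so $F_0=1,F_1=0,F_2=1,F_3=2,\dots$; OEIS A000957). -}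

module Defs where

open import Data.Nat using (ℕ; zero; suc; _+_; _*_; _∸_; _/_; _≡ᵇ_; _≤ᵇ_)
open import Data.Nat.Combinatorics using (_C_)
open import Data.Bool using (Bool; true; false; not; _∧_; if_then_else_)
open import Data.Maybe using (Maybe; just; nothing)
open import Data.Nat.ListAction using (sum)
open import Data.List using (List; []; _∷_; length; map; upTo; replicate; filterᵇ; concatMap; zipWith; reverse)

-- Parking: spots 1..n are represented by a List Bool of length n
-- (true = occupied).  Spots outside 1..n count as "not available".

free : List Bool → ℕ → Bool
free []       _             = false
free (b ∷ bs) zero          = false
free (b ∷ bs) (suc zero)    = not b
free (b ∷ bs) (suc (suc i)) = free bs (suc i)

occupy : List Bool → ℕ → List Bool
occupy []       _             = []
occupy (b ∷ bs) zero          = b ∷ bs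
occupy (b ∷ bs) (suc zero)    = true ∷ bs
occupy (b ∷ bs) (suc (suc i)) = b ∷ occupy bs (suc i)

firstFree : List Bool → List ℕ → Maybe ℕ
firstFree s []       = nothing
firstFree s (j ∷ js) = if free s j then just j else firstFree s js

spotsAfter : ℕ → ℕ → List ℕ
spotsAfter n a = filterᵇ (λ j → a + 1 ≤ᵇ j) (map suc (upTo n))

naplesPark : List Bool → ℕ → Maybe (List Bool)
naplesPark s a =
  if free s a then just (occupy s a)
  else if (2 ≤ᵇ a) ∧ free s (a ∸ 1) then just (occupy s (a ∸ 1))
  else parkAt (firstFree s (spotsAfter (length s) a))
  where
  parkAt : Maybe ℕ → Maybe (List Bool)
  parkAt nothing  = nothing
  parkAt (just j) = just (occupy s j)

allPark : List Bool → List ℕ → Bool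
allPark s []       = true
allPark s (a ∷ as) with naplesPark s a
... | nothing = false
... | just s′ = allPark s′ as

inRange : ℕ → List ℕ → Bool
inRange n []       = true
inRange n (a ∷ as) = (1 ≤ᵇ a) ∧ (a ≤ᵇ n) ∧ inRange n as

isNaplesPF : ℕ → List ℕ → Bool
isNaplesPF n a = (length a ≡ᵇ n) ∧ inRange n a ∧ allPark (replicate n false) a

ascending : List ℕ → Bool
ascending []           = true
ascending (a ∷ [])     = true
ascending (a ∷ b ∷ as) = (a ≤ᵇ b) ∧ ascending (b ∷ as)

firstIsOne : List ℕ → Bool
firstIsOne []       = false
firstIsOne (a ∷ _)  = a ≡ᵇ 1

words : ℕ → ℕ → List (List ℕ)
words n zero    = [] ∷ []
words n (suc k) = concatMap (λ a → map (a ∷_) (words n k)) (map suc (upTo n))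

-- U_{n,1}: number of ascending 1-Naples parking functions of length n
-- with first entry 1 (for n = 0 there is no first entry, so U_{0,1} = 0)
U1 : ℕ → ℕ
U1 n = length (filterᵇ (λ a → ascending a ∧ firstIsOne a ∧ isNaplesPF n a) (words n n))

catalan : ℕ → ℕ
catalan m = ((2 * m) C m) / suc m

catalanSq : ℕ → ℕ
catalanSq k = sum (map (λ i → catalan i * catalan (k ∸ i)) (upTo (suc k)))

-- coefficient of x^k in G(x) = x^2 C(x)^2
G : ℕ → ℕ
G zero          = 0
G (suc zero)    = 0
G (suc (suc k)) = catalanSq k

-- F(x) = 1/(1 - G(x)) means F = 1 + G·F, i.e. F_0 = 1 and
-- F_m = Σ_{k=1}^{m} G_k F_{m-k} for m ≥ 1 (G_0 = 0).
-- fineRev m = [F_m, F_{m-1}, ..., F_0]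
fineRev : ℕ → List ℕ
fineRev zero    = 1 ∷ []
fineRev (suc m) = sum (zipWith _*_ (map (λ i → G (suc i)) (upTo (suc m))) prev) ∷ prev
  where
  prev = fineRev m   -- [F_m, ..., F_0]; pairs G_{i+1} with F_{m-i}

fine : ℕ → ℕ
fine m with fineRev m
... | []    = 0
... | f ∷ _ = f

{-# OPTIONS --safe #-}
-- With weakly increasing preferences, a street on which all remaining cars can still park is
-- an occupied block 1..P followed by empty spots, except right after a car takes spot P + 2.
-- If the previous preference was d + 1, with P = d + K, a car preferring d + 1 + j (j ≤ K)
-- ends up in spot P + 1; a car preferring P + 2 leaves a hole at P + 1 that only the very
-- next car can fill (by preferring P + 2 and backing up), and any larger preference leaves an
-- empty spot behind for good.  So the number N(K, R) of ways to complete with R cars satisfies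
--   N(K, R + 1) = Σ_{j ≤ K} N(K + 1 - j, R) + N(1, R - 1),
-- which is also the recursion of [x^R] C(x)^(K+1) F(x): use C^(a+1) = C^a + x C^(a+2)
-- and F = 1 + x² C² F.  Hence U_{n+1,1} = N(1, n) = [x^n] C² F = F_{n+2}.
module Submission where

open import Defs
open import Data.Nat
open import Data.Nat.Properties
open import Data.Nat.Combinatorics using (_C_; nCk≡nC[n∸k]; nC1≡n; nCk+nC[k+1]≡[n+1]C[k+1])
open import Data.Nat.DivMod using (m*n/n≡m)
open import Data.Nat.ListAction using (sum)
open import Data.Nat.Tactic.RingSolver using (solve-∀)
open import Data.Bool using (Bool; true; false; if_then_else_; _∧_)
open import Data.Bool.Properties using (∧-zeroʳ; ∧-conicalʳ)
open import Data.Maybe using (Maybe; just; nothing)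
open import Data.List
  using (List; []; _∷_; _++_; length; upTo; applyUpTo; map; zipWith; replicate; filterᵇ; concatMap)
open import Data.List.Properties
  using (map-upTo; map-applyUpTo; length-++; length-replicate; filter-++; filter-accept)
open import Data.List.Relation.Unary.All as All using (All; []; _∷_)
open import Data.List.Relation.Unary.All.Properties using (all-filter; filter⁺; applyUpTo⁺₁)
open import Data.Product using (Σ-syntax; _×_; _,_)
open import Data.Sum using (inj₁; inj₂)
open import Function using (_∘_)
open import Relation.Nullary.Decidable using (yes; no; T?; dec-true; dec-false)
open import Relation.Binary.PropositionalEquality
open ≡-Reasoning

-- Finite sums and Cauchy products

∑ : ℕ → (ℕ → ℕ) → ℕ
∑ zero    f = 0
∑ (suc n) f = f 0 + ∑ n (f ∘ suc)

syntax ∑ n (λ i → e) = ∑[ i < n ] e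

∑-cong : ∀ n {f g : ℕ → ℕ} → (∀ i → i < n → f i ≡ g i) → ∑ n f ≡ ∑ n g
∑-cong zero    eq = refl
∑-cong (suc n) eq = cong₂ _+_ (eq 0 z<s) (∑-cong n (λ i i<n → eq (suc i) (s<s i<n)))

∑-zero : ∀ n {f : ℕ → ℕ} → (∀ i → i < n → f i ≡ 0) → ∑ n f ≡ 0
∑-zero zero    eq = refl
∑-zero (suc n) eq = cong₂ _+_ (eq 0 z<s) (∑-zero n (λ i i<n → eq (suc i) (s<s i<n)))

∑-+ : ∀ n (f g : ℕ → ℕ) → ∑[ i < n ] (f i + g i) ≡ ∑ n f + ∑ n g
∑-+ zero    f g = refl
∑-+ (suc n) f g = begin
  f 0 + g 0 + ∑[ i < n ] (f (suc i) + g (suc i)) ≡⟨ cong (f 0 + g 0 +_) (∑-+ n (f ∘ suc) (g ∘ suc)) ⟩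
  f 0 + g 0 + (∑ n (f ∘ suc) + ∑ n (g ∘ suc))    ≡⟨ interchange (f 0) (g 0) _ _ ⟩
  f 0 + ∑ n (f ∘ suc) + (g 0 + ∑ n (g ∘ suc))    ∎
  where
  interchange : ∀ a b c d → a + b + (c + d) ≡ a + c + (b + d)
  interchange = solve-∀

∑-*ʳ : ∀ n (f : ℕ → ℕ) c → ∑[ i < n ] (f i * c) ≡ ∑ n f * c
∑-*ʳ zero    f c = refl
∑-*ʳ (suc n) f c = trans (cong (f 0 * c +_) (∑-*ʳ n (f ∘ suc) c)) (sym (*-distribʳ-+ c (f 0) _))

∑-swap : ∀ m n (f : ℕ → ℕ → ℕ) → ∑[ i < m ] ∑[ j < n ] f i j ≡ ∑[ j < n ] ∑[ i < m ] f i j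
∑-swap zero    n f = sym (∑-zero n (λ _ _ → refl))
∑-swap (suc m) n f = trans (cong (∑ n (f 0) +_) (∑-swap m n (f ∘ suc)))
                           (sym (∑-+ n (f 0) (λ j → ∑[ i < m ] f (suc i) j)))

∑-split : ∀ m n (f : ℕ → ℕ) → ∑ (m + n) f ≡ ∑ m f + ∑[ i < n ] f (m + i)
∑-split zero    n f = refl
∑-split (suc m) n f = trans (cong (f 0 +_) (∑-split m n (f ∘ suc))) (sym (+-assoc (f 0) _ _))

sum-applyUpTo : ∀ n (f : ℕ → ℕ) → sum (applyUpTo f n) ≡ ∑ n f
sum-applyUpTo zero    f = refl
sum-applyUpTo (suc n) f = cong (f 0 +_) (sum-applyUpTo n (f ∘ suc))

sum-zipWith-applyUpTo : ∀ n (f g : ℕ → ℕ) →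
                        sum (zipWith _*_ (applyUpTo f n) (applyUpTo g n)) ≡ ∑[ i < n ] (f i * g i)
sum-zipWith-applyUpTo zero    f g = refl
sum-zipWith-applyUpTo (suc n) f g = cong (f 0 * g 0 +_) (sum-zipWith-applyUpTo n (f ∘ suc) (g ∘ suc))

_⋆_ : (ℕ → ℕ) → (ℕ → ℕ) → ℕ → ℕ
(f ⋆ g) k = ∑[ i < suc k ] (f i * g (k ∸ i))

-- Powers of the Catalan series

-- ballot a j is the coefficient of x^j in C(x)^a; the recursion is C^(a+1) = C^a + x C^(a+2),
-- a consequence of C = 1 + x C².
ballot : ℕ → ℕ → ℕ
ballot zero    zero    = 1
ballot zero    (suc j) = 0
ballot (suc a) zero    = 1
ballot (suc a) (suc j) = ballot a (suc j) + ballot (suc (suc a)) j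

ballot-zero : ∀ a → ballot a 0 ≡ 1
ballot-zero zero    = refl
ballot-zero (suc a) = refl

ballot-⋆ : ∀ a b k → (ballot a ⋆ ballot b) k ≡ ballot (a + b) k
ballot-⋆ zero    b k =
  trans (cong₂ _+_ (+-identityʳ (ballot b k)) (∑-zero k (λ _ _ → refl))) (+-identityʳ (ballot b k))
ballot-⋆ (suc a) b zero    = cong (λ x → x + 0 + 0) (ballot-zero b)
ballot-⋆ (suc a) b (suc k) = begin
  ballot b (suc k) + 0 + ∑[ i < suc k ] ((ballot a (suc i) + ballot (2 + a) i) * ballot b (k ∸ i))
    ≡⟨ cong (ballot b (suc k) + 0 +_) (trans (∑-cong (suc k) distrib) (∑-+ (suc k) lower upper)) ⟩
  ballot b (suc k) + 0 + (∑ (suc k) lower + ∑ (suc k) upper)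
    ≡⟨ +-assoc (ballot b (suc k) + 0) _ _ ⟨
  ballot b (suc k) + 0 + ∑ (suc k) lower + ∑ (suc k) upper
    ≡⟨ cong₂ _+_ (cong (λ x → x * ballot b (suc k) + ∑ (suc k) lower) (sym (ballot-zero a)))
                 (ballot-⋆ (2 + a) b k) ⟩
  (ballot a ⋆ ballot b) (suc k) + ballot (2 + a + b) k
    ≡⟨ cong (_+ ballot (2 + a + b) k) (ballot-⋆ a b (suc k)) ⟩
  ballot (a + b) (suc k) + ballot (2 + a + b) k
    ∎
  where
  lower upper : ℕ → ℕ
  lower i = ballot a (suc i) * ballot b (k ∸ i)
  upper i = ballot (2 + a) i * ballot b (k ∸ i)
  distrib : ∀ i → i < suc k → (ballot a (suc i) + ballot (2 + a) i) * ballot b (k ∸ i) ≡ lower i + upper i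
  distrib i _ = *-distribʳ-+ (ballot b (k ∸ i)) (ballot a (suc i)) (ballot (2 + a) i)

ballot-suc-suc : ∀ K R → ballot (suc K) (suc R) ≡ ∑[ i < suc K ] ballot (suc (suc (K ∸ i))) R
ballot-suc-suc zero    R = sym (+-identityʳ _)
ballot-suc-suc (suc K) R =
  trans (cong (_+ ballot (3 + K) R) (ballot-suc-suc K R)) (+-comm _ (ballot (3 + K) R))

_Cᵖ_ : ℕ → ℕ → ℕ
n Cᵖ zero  = 0
n Cᵖ suc k = n C k

pascalᵖ : ∀ n k → n Cᵖ k + n C k ≡ suc n C k
pascalᵖ n zero    = refl
pascalᵖ n (suc k) = nCk+nC[k+1]≡[n+1]C[k+1] n k

absorption : ∀ n k → suc k * (suc n C suc k) ≡ suc n * (n C k)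
absorption zero    zero    = refl
absorption zero    (suc k) = *-zeroʳ (suc (suc k))
absorption (suc n) zero    =
  trans (+-identityʳ _) (trans (nC1≡n (suc (suc n))) (sym (*-identityʳ (suc (suc n)))))
absorption (suc n) (suc k) = begin
  (2 + k) * ((2 + n) C (2 + k))
    ≡⟨ cong ((2 + k) *_) (nCk+nC[k+1]≡[n+1]C[k+1] (suc n) (suc k)) ⟨
  (2 + k) * (X + Y)
    ≡⟨ regroup X Y k ⟩
  X + (1 + k) * X + (2 + k) * Y
    ≡⟨ cong₂ (λ u v → X + u + v) (absorption n k) (absorption n (suc k)) ⟩
  X + (1 + n) * (n C k) + (1 + n) * (n C suc k)
    ≡⟨ +-assoc X _ _ ⟩
  X + ((1 + n) * (n C k) + (1 + n) * (n C suc k))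
    ≡⟨ cong (X +_) (*-distribˡ-+ (1 + n) (n C k) _) ⟨
  X + (1 + n) * (n C k + n C suc k)
    ≡⟨ cong (λ u → X + (1 + n) * u) (nCk+nC[k+1]≡[n+1]C[k+1] n k) ⟩
  X + (1 + n) * X
    ∎
  where
  X = suc n C suc k
  Y = suc n C suc (suc k)
  regroup : ∀ X Y k → (2 + k) * (X + Y) ≡ X + (1 + k) * X + (2 + k) * Y
  regroup = solve-∀

C-symmetric : ∀ {n i j} → i ≤ n → n ∸ i ≡ j → n C i ≡ n C j
C-symmetric i≤n refl = nCk≡nC[n∸k] i≤n

binomial-ratio : ∀ k l → suc l * ((k + suc l) C k) ≡ suc k * ((k + suc l) C suc k)
binomial-ratio k l rewrite +-suc k l = begin
  suc l * (suc (k + l) C k)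
    ≡⟨ cong (suc l *_) (C-symmetric (m≤n⇒m≤1+n (m≤m+n k l))
                                    (trans (+-∸-assoc 1 (m≤m+n k l)) (cong suc (m+n∸m≡n k l)))) ⟩
  suc l * (suc (k + l) C suc l) ≡⟨ absorption (k + l) l ⟩
  suc (k + l) * ((k + l) C l)   ≡⟨ cong (suc (k + l) *_) (C-symmetric (m≤n+m l k) (m+n∸n≡m k l)) ⟩
  suc (k + l) * ((k + l) C k)   ≡⟨ absorption (k + l) k ⟨
  suc k * (suc (k + l) C suc k) ∎

central-symmetry : ∀ j → suc (j + j) C j ≡ suc (j + j) C suc j
central-symmetry j = C-symmetric (m≤n⇒m≤1+n (m≤m+n j j))
                                 (trans (+-∸-assoc 1 (m≤m+n j j)) (cong suc (m+n∸m≡n j j)))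

pascal-combine : ∀ N j {X Y} → X + N C j ≡ N C suc j → Y + N Cᵖ j ≡ N C j →
                 X + Y + suc N C j ≡ suc N C suc j
pascal-combine N j {X} {Y} upper lower = begin
  X + Y + suc N C j          ≡⟨ cong (X + Y +_) (pascalᵖ N j) ⟨
  X + Y + (N Cᵖ j + N C j)   ≡⟨ regroup X Y (N Cᵖ j) (N C j) ⟩
  (X + N C j) + (Y + N Cᵖ j) ≡⟨ cong₂ _+_ upper lower ⟩
  N C suc j + N C j          ≡⟨ +-comm (N C suc j) (N C j) ⟩
  N C j + N C suc j          ≡⟨ nCk+nC[k+1]≡[n+1]C[k+1] N j ⟩
  suc N C suc j              ∎
  where
  regroup : ∀ X Y P Q → X + Y + (P + Q) ≡ (X + Q) + (Y + P)
  regroup = solve-∀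

double-suc : ∀ j a → suc j + suc j + a ≡ suc (suc (j + j + a))
double-suc j a = cong (λ m → suc m + a) (+-suc j j)

ballot-binomial-step : ∀ j a → let N = suc (j + j + a) in
  ballot a (suc j) + N C j ≡ N C suc j → ballot (2 + a) j + N Cᵖ j ≡ N C j →
  ballot (suc a) (suc j) + (suc j + suc j + a) Cᵖ suc j ≡ (suc j + suc j + a) C suc j
ballot-binomial-step j a upper lower =
  subst (λ m → ballot (suc a) (suc j) + m Cᵖ suc j ≡ m C suc j) (sym (double-suc j a))
        (pascal-combine (suc (j + j + a)) j upper lower)

ballot-binomial : ∀ j a → ballot (suc a) j + (j + j + a) Cᵖ j ≡ (j + j + a) C j
ballot-binomial zero    a       = refl
ballot-binomial (suc j) zero    = ballot-binomial-step j 0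
  (subst (λ m → suc m C j ≡ suc m C suc j) (sym (+-identityʳ (j + j))) (central-symmetry j))
  (subst (λ m → ballot 2 j + m Cᵖ j ≡ m C j) (+-suc (j + j) 0) (ballot-binomial j 1))
ballot-binomial (suc j) (suc a) = ballot-binomial-step j (suc a)
  (subst (λ m → ballot (suc a) (suc j) + m Cᵖ suc j ≡ m C suc j)
         (trans (double-suc j a) (cong suc (sym (+-suc (j + j) a))))
         (ballot-binomial (suc j) a))
  (subst (λ m → ballot (3 + a) j + m Cᵖ j ≡ m C j) (+-suc (j + j) (suc a)) (ballot-binomial j (2 + a)))

ballot-one : ∀ m → ballot 1 m * suc m ≡ (2 * m) C m
ballot-one zero    = refl
ballot-one (suc k) = cancel {ballot 1 (suc k)} {(2 * suc k) C k}
  (subst (λ m → ballot 1 (suc k) + m C k ≡ m C suc k) (double₁ k) (ballot-binomial (suc k) 0))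
  (subst (λ m → suc (suc k) * (m C k) ≡ suc k * (m C suc k)) (double₂ k) (binomial-ratio k (suc k)))
  where
  double₁ : ∀ k → suc k + suc k + 0 ≡ 2 * suc k
  double₁ = solve-∀
  double₂ : ∀ k → k + suc (suc k) ≡ 2 * suc k
  double₂ = solve-∀
  cancel : ∀ {x b B} → x + b ≡ B → suc (suc k) * b ≡ suc k * B → x * suc (suc k) ≡ B
  cancel {x} {b} {B} x+b≡B ratio = +-cancelʳ-≡ (b * suc (suc k)) _ _ (begin
    x * suc (suc k) + b * suc (suc k) ≡⟨ *-distribʳ-+ (suc (suc k)) x b ⟨
    (x + b) * suc (suc k)             ≡⟨ cong (_* suc (suc k)) x+b≡B ⟩
    B * suc (suc k)                   ≡⟨ *-comm B (suc (suc k)) ⟩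
    B + suc k * B                     ≡⟨ cong (B +_) ratio ⟨
    B + suc (suc k) * b               ≡⟨ cong (B +_) (*-comm (suc (suc k)) b) ⟩
    B + b * suc (suc k)               ∎)

catalan≡ballot : ∀ m → catalan m ≡ ballot 1 m
catalan≡ballot m = trans (cong (_/ suc m) (sym (ballot-one m))) (m*n/n≡m (ballot 1 m) (suc m))

catalanSq≡ballot : ∀ k → catalanSq k ≡ ballot 2 k
catalanSq≡ballot k = begin
  sum (map term (upTo (suc k)))  ≡⟨ cong sum (map-upTo term (suc k)) ⟩
  sum (applyUpTo term (suc k))   ≡⟨ sum-applyUpTo (suc k) term ⟩
  (catalan ⋆ catalan) k
    ≡⟨ ∑-cong (suc k) (λ i _ → cong₂ _*_ (catalan≡ballot i) (catalan≡ballot (k ∸ i))) ⟩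
  (ballot 1 ⋆ ballot 1) k        ≡⟨ ballot-⋆ 1 1 k ⟩
  ballot 2 k                     ∎
  where
  term : ℕ → ℕ
  term i = catalan i * catalan (k ∸ i)

fineRev≡applyUpTo : ∀ m → fineRev m ≡ applyUpTo (λ i → fine (m ∸ i)) (suc m)
fineRev≡applyUpTo zero    = refl
fineRev≡applyUpTo (suc m) = cong (fine (suc m) ∷_) (fineRev≡applyUpTo m)

fine-suc : ∀ m → fine (suc m) ≡ ∑[ i < suc m ] (G (suc i) * fine (m ∸ i))
fine-suc m = begin
  sum (zipWith _*_ (map g (upTo (suc m))) (fineRev m))
    ≡⟨ cong₂ (λ xs ys → sum (zipWith _*_ xs ys)) (map-upTo g (suc m)) (fineRev≡applyUpTo m) ⟩
  sum (zipWith _*_ (applyUpTo g (suc m)) (applyUpTo (λ i → fine (m ∸ i)) (suc m)))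
    ≡⟨ sum-zipWith-applyUpTo (suc m) g (λ i → fine (m ∸ i)) ⟩
  ∑[ i < suc m ] (G (suc i) * fine (m ∸ i))
    ∎
  where
  g : ℕ → ℕ
  g i = G (suc i)

fine-suc-suc : ∀ m → fine (suc (suc m)) ≡ (ballot 2 ⋆ fine) m
fine-suc-suc m = trans (fine-suc (suc m))
  (∑-cong (suc m) {g = λ i → ballot 2 i * fine (m ∸ i)} (λ i _ → cong (_* fine (m ∸ i)) (catalanSq≡ballot i)))

ballot⋆fine-suc : ∀ K R → (ballot (suc K) ⋆ fine) (suc R) ≡
                          ∑[ i < suc K ] (ballot (suc (suc (K ∸ i))) ⋆ fine) R + fine (suc R)
ballot⋆fine-suc K R = begin
  fine (suc R) + 0 + ∑[ r < suc R ] (ballot (suc K) (suc r) * fine (R ∸ r))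
    ≡⟨ cong₂ _+_ (+-identityʳ (fine (suc R)))
                 (∑-cong (suc R) (λ r _ → cong (_* fine (R ∸ r)) (ballot-suc-suc K r))) ⟩
  fine (suc R) + ∑[ r < suc R ] (∑[ i < suc K ] b i r * fine (R ∸ r))
    ≡⟨ cong (fine (suc R) +_) (∑-cong (suc R) (λ r _ → sym (∑-*ʳ (suc K) (λ i → b i r) (fine (R ∸ r))))) ⟩
  fine (suc R) + ∑[ r < suc R ] ∑[ i < suc K ] (b i r * fine (R ∸ r))
    ≡⟨ cong (fine (suc R) +_) (∑-swap (suc R) (suc K) (λ r i → b i r * fine (R ∸ r))) ⟩
  fine (suc R) + ∑[ i < suc K ] (b i ⋆ fine) R
    ≡⟨ +-comm (fine (suc R)) _ ⟩
  ∑[ i < suc K ] (b i ⋆ fine) R + fine (suc R)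
    ∎
  where
  b : ℕ → ℕ → ℕ
  b i = ballot (suc (suc (K ∸ i)))

-- Streets with an occupied initial block

filled : ℕ → ℕ → List Bool
filled P R = replicate P true ++ replicate R false

holed : ℕ → ℕ → List Bool
holed P R = replicate P true ++ false ∷ true ∷ replicate R false

free-zero : ∀ s → free s 0 ≡ false
free-zero []      = refl
free-zero (_ ∷ _) = refl

free-replicate-true : ∀ P xs {j} → j ≤ P → free (replicate P true ++ xs) j ≡ false
free-replicate-true P       xs {zero}        _         = free-zero (replicate P true ++ xs)
free-replicate-true (suc P) xs {suc zero}    _         = refl
free-replicate-true (suc P) xs {suc (suc j)} (s≤s j<P) = free-replicate-true P xs j<P

free-filled-next : ∀ P R → free (filled P (suc R)) (suc P) ≡ true
free-filled-next zero    R = refl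
free-filled-next (suc P) R = free-filled-next P R

occupy-filled-next : ∀ P R → occupy (filled P (suc R)) (suc P) ≡ filled (suc P) R
occupy-filled-next zero    R = refl
occupy-filled-next (suc P) R = cong (true ∷_) (occupy-filled-next P R)

free-filled-hole : ∀ P R → free (filled P (2 + R)) (2 + P) ≡ true
free-filled-hole zero    R = refl
free-filled-hole (suc P) R = free-filled-hole P R

occupy-filled-hole : ∀ P R → occupy (filled P (2 + R)) (2 + P) ≡ holed P R
occupy-filled-hole zero    R = refl
occupy-filled-hole (suc P) R = cong (true ∷_) (occupy-filled-hole P R)

free-holed-taken : ∀ P R → free (holed P R) (2 + P) ≡ false
free-holed-taken zero    R = refl
free-holed-taken (suc P) R = free-holed-taken P R

free-holed-hole : ∀ P R → free (holed P R) (suc P) ≡ true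
free-holed-hole zero    R = refl
free-holed-hole (suc P) R = free-holed-hole P R

occupy-holed-hole : ∀ P R → occupy (holed P R) (suc P) ≡ filled (2 + P) R
occupy-holed-hole zero    R = refl
occupy-holed-hole (suc P) R = cong (true ∷_) (occupy-holed-hole P R)

length-filled : ∀ P R → length (filled P R) ≡ P + R
length-filled P R =
  trans (length-++ (replicate P true)) (cong₂ _+_ (length-replicate P) (length-replicate R))

applyUpTo-+ : ∀ (f : ℕ → ℕ) m n → applyUpTo f (m + n) ≡ applyUpTo f m ++ applyUpTo (λ i → f (m + i)) n
applyUpTo-+ f zero    n = refl
applyUpTo-+ f (suc m) n = cong (f 0 ∷_) (applyUpTo-+ (f ∘ suc) m n)

firstFree-skip : ∀ s {xs} ys → All (λ j → free s j ≡ false) xs → firstFree s (xs ++ ys) ≡ firstFree s ys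
firstFree-skip s ys []                      = refl
firstFree-skip s ys (_∷_ {x} occupied rest) rewrite occupied = firstFree-skip s ys rest

firstFree-sound : ∀ {Q : ℕ → Set} s {js j} → All Q js → firstFree s js ≡ just j → Q j × free s j ≡ true
firstFree-sound s {x ∷ js} (qx ∷ qjs) found with free s x in eq
... | true  with refl ← found = qx , eq
... | false = firstFree-sound s qjs found

spotsAfter-> : ∀ n a → All (a <_) (spotsAfter n a)
spotsAfter-> n a = All.map (λ {j} a+1≤j → subst (_≤ j) (+-comm a 1) (≤ᵇ⇒≤ (a + 1) j a+1≤j))
                           (all-filter (λ j → T? (a + 1 ≤ᵇ j)) (map suc (upTo n)))

firstFree-filled : ∀ P R {a} → a ≤ P →
                   firstFree (filled P (suc R)) (spotsAfter (P + suc R) a) ≡ just (suc P)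
firstFree-filled P R {a} a≤P = begin
  firstFree s (filterᵇ after (map suc (upTo (P + suc R))))
    ≡⟨ cong (firstFree s ∘ filterᵇ after) (trans (map-upTo suc (P + suc R)) (applyUpTo-+ suc P (suc R))) ⟩
  firstFree s (filterᵇ after (applyUpTo suc P ++ suc (P + 0) ∷ later))
    ≡⟨ cong (firstFree s) (filter-++ (T? ∘ after) (applyUpTo suc P) _) ⟩
  firstFree s (filterᵇ after (applyUpTo suc P) ++ filterᵇ after (suc (P + 0) ∷ later))
    ≡⟨ firstFree-skip s _ (filter⁺ (T? ∘ after) (applyUpTo⁺₁ suc P (free-replicate-true P _))) ⟩
  firstFree s (filterᵇ after (suc (P + 0) ∷ later))
    ≡⟨ cong (firstFree s) (filter-accept (T? ∘ after) (≤⇒≤ᵇ {a + 1} {suc (P + 0)} a<P+1)) ⟩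
  firstFree s (suc (P + 0) ∷ filterᵇ after later)
    ≡⟨ cong (λ j → firstFree s (suc j ∷ filterᵇ after later)) (+-identityʳ P) ⟩
  firstFree s (suc P ∷ filterᵇ after later)
    ≡⟨ cong (λ b → if b then just (suc P) else firstFree s (filterᵇ after later)) (free-filled-next P R) ⟩
  just (suc P)
    ∎
  where
  s = filled P (suc R)
  after : ℕ → Bool
  after j = a + 1 ≤ᵇ j
  later = applyUpTo (λ i → suc (P + suc i)) R
  a<P+1 : a + 1 ≤ suc (P + 0)
  a<P+1 = subst₂ _≤_ (+-comm 1 a) (cong suc (sym (+-identityʳ P))) (s≤s a≤P)

naplesPark-here : ∀ s {a} → free s a ≡ true → naplesPark s a ≡ just (occupy s a)
naplesPark-here s here rewrite here = refl

naplesPark-back : ∀ s {a} → free s a ≡ false → ((2 ≤ᵇ a) ∧ free s (a ∸ 1)) ≡ true →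
                  naplesPark s a ≡ just (occupy s (a ∸ 1))
naplesPark-back s here back rewrite here | back = refl

naplesPark-forward : ∀ s {a j} → free s a ≡ false → ((2 ≤ᵇ a) ∧ free s (a ∸ 1)) ≡ false →
                     firstFree s (spotsAfter (length s) a) ≡ just j → naplesPark s a ≡ just (occupy s j)
naplesPark-forward s here back forward rewrite here | back | forward = refl

naplesPark-filled : ∀ P R {a} → a ≤ suc P → naplesPark (filled P (suc R)) a ≡ just (filled (suc P) R)
naplesPark-filled P R {a} a≤ with m≤n⇒m<n∨m≡n a≤
... | inj₂ refl      = trans (naplesPark-here s (free-filled-next P R)) (cong just (occupy-filled-next P R))
  where s = filled P (suc R)
... | inj₁ (s≤s a≤P) = trans (naplesPark-forward s taken back-taken forward) (cong just (occupy-filled-next P R))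
  where
  s = filled P (suc R)
  taken : free s a ≡ false
  taken = free-replicate-true P _ a≤P
  back-taken : ((2 ≤ᵇ a) ∧ free s (a ∸ 1)) ≡ false
  back-taken = trans (cong ((2 ≤ᵇ a) ∧_) (free-replicate-true P _ (≤-trans (m∸n≤m a 1) a≤P)))
                     (∧-zeroʳ (2 ≤ᵇ a))
  forward : firstFree s (spotsAfter (length s) a) ≡ just (suc P)
  forward = trans (cong (λ n → firstFree s (spotsAfter n a)) (length-filled P (suc R)))
                  (firstFree-filled P R a≤P)

naplesPark-hole : ∀ P R → naplesPark (filled P (2 + R)) (2 + P) ≡ just (holed P R)
naplesPark-hole P R =
  trans (naplesPark-here (filled P (2 + R)) (free-filled-hole P R)) (cong just (occupy-filled-hole P R))

naplesPark-holed : ∀ P R → naplesPark (holed P R) (2 + P) ≡ just (filled (2 + P) R)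
naplesPark-holed P R =
  trans (naplesPark-back (holed P R) (free-holed-taken P R) (free-holed-hole P R))
        (cong just (occupy-holed-hole P R))

naplesPark-spot : ∀ s a {s′} → naplesPark s a ≡ just s′ →
                  Σ[ j ∈ ℕ ] free s j ≡ true × occupy s j ≡ s′ × a ∸ 1 ≤ j
naplesPark-spot s a parked with free s a in here
... | true with refl ← parked = a , here , refl , m∸n≤m a 1
... | false with (2 ≤ᵇ a) ∧ free s (a ∸ 1) in back
...   | true with refl ← parked = a ∸ 1 , ∧-conicalʳ (2 ≤ᵇ a) _ back , refl , ≤-refl
...   | false with firstFree s (spotsAfter (length s) a) in forward
...     | just j with refl ← parked
                 with a<j , freeⱼ ← firstFree-sound s (spotsAfter-> (length s) a) forward =
  j , freeⱼ , refl , ≤-trans (m∸n≤m a 1) (<⇒≤ a<j)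

freeAfter : List Bool → ℕ → ℕ
freeAfter []          _       = 0
freeAfter (_     ∷ s) (suc q) = freeAfter s q
freeAfter (false ∷ s) zero    = suc (freeAfter s zero)
freeAfter (true  ∷ s) zero    = freeAfter s zero

freeAfter-occupy : ∀ s {j q} → free s j ≡ true → q < j → suc (freeAfter (occupy s j) q) ≡ freeAfter s q
freeAfter-occupy (false ∷ s) {suc zero}    {zero}  _    _         = refl
freeAfter-occupy (false ∷ s) {suc zero}    {suc q} _    (s≤s ())
freeAfter-occupy (false ∷ s) {suc (suc j)} {zero}  free _         = cong suc (freeAfter-occupy s free z<s)
freeAfter-occupy (true  ∷ s) {suc (suc j)} {zero}  free _         = freeAfter-occupy s free z<s
freeAfter-occupy (_     ∷ s) {suc (suc j)} {suc q} free (s≤s q<j) = freeAfter-occupy s free q<j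

freeAfter-naplesPark : ∀ s {a s′ q} → naplesPark s a ≡ just s′ → suc (suc q) ≤ a →
                       suc (freeAfter s′ q) ≡ freeAfter s q
freeAfter-naplesPark s {a} parked q+2≤a with naplesPark-spot s a parked
... | j , freeⱼ , refl , a-1≤j = freeAfter-occupy s freeⱼ (≤-trans (∸-monoˡ-≤ 1 q+2≤a) a-1≤j)

freeAfter-replicate-false : ∀ R → freeAfter (replicate R false) 0 ≡ R
freeAfter-replicate-false zero    = refl
freeAfter-replicate-false (suc R) = cong suc (freeAfter-replicate-false R)

freeAfter-filled : ∀ P R → freeAfter (filled P (2 + R)) (suc P) ≡ suc R
freeAfter-filled zero    R = cong suc (freeAfter-replicate-false R)
freeAfter-filled (suc P) R = freeAfter-filled P R

freeAfter-holed : ∀ P R → freeAfter (holed P R) (suc P) ≡ R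
freeAfter-holed zero    R = freeAfter-replicate-false R
freeAfter-holed (suc P) R = freeAfter-holed P R

-- Counting ascending completions

parkings     : ℕ → List Bool → ℕ → ℕ → ℕ
parkingsAt   : ℕ → List Bool → ℕ → ℕ → ℕ → ℕ
parkingsFrom : ℕ → Maybe (List Bool) → ℕ → ℕ → ℕ

parkings n s p zero    = 1
parkings n s p (suc k) = ∑[ i < n ] parkingsAt n s p k (suc i)

parkingsAt n s p k a = if p ≤ᵇ a then parkingsFrom n (naplesPark s a) a k else 0

parkingsFrom n nothing  p k = 0
parkingsFrom n (just s) p k = parkings n s p k

parkingsAt-below : ∀ n s {p} k {a} → a < p → parkingsAt n s p k a ≡ 0
parkingsAt-below n s {p} k {a} a<p rewrite dec-false (p ≤? a) (<⇒≱ a<p) = refl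

parkingsAt-accept : ∀ n s {p} k {a} → p ≤ a → parkingsAt n s p k a ≡ parkingsFrom n (naplesPark s a) a k
parkingsAt-accept n s {p} k {a} p≤a rewrite dec-true (p ≤? a) p≤a = refl

parkingsAt-park : ∀ n s {p} k {a s′} → p ≤ a → naplesPark s a ≡ just s′ →
                  parkingsAt n s p k a ≡ parkings n s′ a k
parkingsAt-park n s k p≤a parked =
  trans (parkingsAt-accept n s k p≤a) (cong (λ m → parkingsFrom n m _ k) parked)

-- A car preferring a ≥ q + 2 parks beyond q, so every remaining car needs its own empty spot beyond q.
parkings-stuck     : ∀ n s {p} k q → suc (suc q) ≤ p → freeAfter s q < k → parkings n s p k ≡ 0
parkingsFrom-stuck : ∀ n s k q {a} → suc (suc q) ≤ a → freeAfter s q ≤ k →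
                     parkingsFrom n (naplesPark s a) a k ≡ 0

parkings-stuck n s {p} (suc k) q q+2≤p (s≤s few) = ∑-zero n stuck
  where
  stuck : ∀ i → i < n → parkingsAt n s p k (suc i) ≡ 0
  stuck i _ with p ≤? suc i
  ... | yes p≤a = trans (parkingsAt-accept n s k p≤a) (parkingsFrom-stuck n s k q (≤-trans q+2≤p p≤a) few)
  ... | no  p≰a = parkingsAt-below n s k (≰⇒> p≰a)
parkingsFrom-stuck n s k q {a} q+2≤a few with naplesPark s a in parked
... | nothing = refl
... | just s′ =
  parkings-stuck n s′ k q q+2≤a (subst (_≤ k) (sym (freeAfter-naplesPark s parked q+2≤a)) few)

-- Only K, the number of occupied spots that the remaining cars may still prefer, matters.
FilledParkings : ℕ → Set
FilledParkings R = ∀ d K {P n} → P ≡ d + K → n ≡ P + R →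
                   parkings n (filled P R) (suc d) R ≡ (ballot (suc K) ⋆ fine) R

parkings-holed : ∀ R → FilledParkings R → ∀ P {n} → n ≡ P + suc (suc R) →
                 parkings n (holed P R) (2 + P) (suc R) ≡ fine (2 + R)
parkings-holed R filled-R P {n} refl = begin
  ∑[ i < P + suc (suc R) ] g i                   ≡⟨ cong (λ m → ∑ m g) (+-suc P (suc R)) ⟩
  ∑[ i < suc P + suc R ] g i                     ≡⟨ ∑-split (suc P) (suc R) g ⟩
  ∑ (suc P) g + (g (suc P + 0) + ∑[ t < R ] g (suc P + suc t))
    ≡⟨ cong₂ (λ x y → x + (y + ∑[ t < R ] g (suc P + suc t))) (∑-zero (suc P) below)
                                                               (cong g (+-identityʳ (suc P))) ⟩
  g (suc P) + ∑[ t < R ] g (suc P + suc t)       ≡⟨ cong₂ _+_ refill (∑-zero R stuck) ⟩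
  (ballot 2 ⋆ fine) R + 0                        ≡⟨ +-identityʳ _ ⟩
  (ballot 2 ⋆ fine) R                            ≡⟨ fine-suc-suc R ⟨
  fine (2 + R)                                   ∎
  where
  s = holed P R
  g : ℕ → ℕ
  g i = parkingsAt (P + suc (suc R)) s (2 + P) R (suc i)
  below : ∀ i → i < suc P → g i ≡ 0
  below i i≤P = parkingsAt-below _ s R (s≤s i≤P)
  refill : g (suc P) ≡ (ballot 2 ⋆ fine) R
  refill = trans (parkingsAt-park _ s R ≤-refl (naplesPark-holed P R))
                 (filled-R (suc P) 1 (sym (+-comm (suc P) 1)) (trans (+-suc P (suc R)) (cong suc (+-suc P R))))
  stuck : ∀ t → t < R → g (suc P + suc t) ≡ 0
  stuck t _ = trans (parkingsAt-accept _ s R (s≤s (s≤s (m≤m+n P (suc t)))))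
                    (parkingsFrom-stuck _ s R (suc P) (s≤s (s≤s (m<m+n P z<s)))
                                        (≤-reflexive (freeAfter-holed P R)))

suc[d+K]≡d+j+suc[K∸j] : ∀ d K {j} → j ≤ K → suc (d + K) ≡ d + j + suc (K ∸ j)
suc[d+K]≡d+j+suc[K∸j] d K {j} j≤K = begin
  suc (d + K)             ≡⟨ cong (λ m → suc (d + m)) (m+[n∸m]≡n j≤K) ⟨
  suc (d + (j + (K ∸ j))) ≡⟨ cong suc (+-assoc d j (K ∸ j)) ⟨
  suc (d + j + (K ∸ j))   ≡⟨ +-suc (d + j) (K ∸ j) ⟨
  d + j + suc (K ∸ j)     ∎

parkings-filled : ∀ R → FilledParkings R
parkings-beyond : ∀ R P {n} → n ≡ P + suc R →
  ∑[ t < R ] parkingsFrom n (naplesPark (filled P (suc R)) (2 + P + t)) (2 + P + t) R ≡ fine (suc R)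

parkings-filled zero    d K _    _    = refl
parkings-filled (suc R) d K refl refl = begin
  ∑[ i < d + K + suc R ] f i                                 ≡⟨ cong (λ m → ∑ m f) (+-suc (d + K) R) ⟩
  ∑[ i < suc (d + K) + R ] f i                               ≡⟨ ∑-split (suc (d + K)) R f ⟩
  ∑[ i < suc (d + K) ] f i + ∑[ t < R ] f (suc (d + K) + t)
    ≡⟨ cong₂ _+_ (cong (λ m → ∑ m f) (sym (+-suc d K))) (∑-cong R beyond) ⟩
  ∑[ i < d + suc K ] f i + ∑[ t < R ] g t
    ≡⟨ cong₂ _+_ (∑-split d (suc K) f) (parkings-beyond R (d + K) refl) ⟩
  ∑ d f + ∑[ j < suc K ] f (d + j) + fine (suc R)
    ≡⟨ cong (λ x → x + ∑[ j < suc K ] f (d + j) + fine (suc R)) (∑-zero d below) ⟩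
  ∑[ j < suc K ] f (d + j) + fine (suc R)                    ≡⟨ cong (_+ fine (suc R)) (∑-cong (suc K) block) ⟩
  ∑[ j < suc K ] (ballot (2 + (K ∸ j)) ⋆ fine) R + fine (suc R) ≡⟨ ballot⋆fine-suc K R ⟨
  (ballot (suc K) ⋆ fine) (suc R)                            ∎
  where
  n = d + K + suc R
  s = filled (d + K) (suc R)
  f g : ℕ → ℕ
  f i = parkingsAt n s (suc d) R (suc i)
  g t = parkingsFrom n (naplesPark s (2 + (d + K) + t)) (2 + (d + K) + t) R
  below : ∀ i → i < d → f i ≡ 0
  below i i<d = parkingsAt-below n s R (s≤s i<d)
  block : ∀ j → j < suc K → f (d + j) ≡ (ballot (2 + (K ∸ j)) ⋆ fine) R
  block j (s≤s j≤K) =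
    trans (parkingsAt-park n s R (s≤s (m≤m+n d j)) (naplesPark-filled (d + K) R (s≤s (+-monoʳ-≤ d j≤K))))
          (parkings-filled R (d + j) (suc (K ∸ j)) (suc[d+K]≡d+j+suc[K∸j] d K j≤K) (+-suc (d + K) R))
  beyond : ∀ t → t < R → f (suc (d + K) + t) ≡ g t
  beyond t _ = parkingsAt-accept n s R (s≤s (m≤n⇒m≤1+n (≤-trans (m≤m+n d K) (m≤m+n (d + K) t))))

parkings-beyond zero    P refl = refl
parkings-beyond (suc R) P refl = begin
  h 0 + ∑[ t < R ] h (suc t)                ≡⟨ cong₂ _+_ (cong hAt (+-identityʳ (2 + P))) (∑-zero R stuck) ⟩
  hAt (2 + P) + 0                           ≡⟨ +-identityʳ _ ⟩
  parkingsFrom n (naplesPark s (2 + P)) (2 + P) (suc R)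
    ≡⟨ cong (λ m → parkingsFrom n m (2 + P) (suc R)) (naplesPark-hole P R) ⟩
  parkings n (holed P R) (2 + P) (suc R)    ≡⟨ parkings-holed R (parkings-filled R) P refl ⟩
  fine (2 + R)                              ∎
  where
  n = P + suc (suc R)
  s = filled P (2 + R)
  hAt h : ℕ → ℕ
  hAt a = parkingsFrom n (naplesPark s a) a (suc R)
  h t = hAt (2 + P + t)
  stuck : ∀ t → t < R → h (suc t) ≡ 0
  stuck t _ = parkingsFrom-stuck n s (suc R) (suc P) (s≤s (s≤s (m<m+n P z<s)))
                                 (≤-reflexive (freeAfter-filled P R))

countᵇ : {A : Set} → (A → Bool) → List A → ℕ
countᵇ p xs = length (filterᵇ p xs)

countᵇ-++ : {A : Set} (p : A → Bool) (xs ys : List A) → countᵇ p (xs ++ ys) ≡ countᵇ p xs + countᵇ p ys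
countᵇ-++ p []       ys = refl
countᵇ-++ p (x ∷ xs) ys with p x
... | true  = cong suc (countᵇ-++ p xs ys)
... | false = countᵇ-++ p xs ys

countᵇ-map : {A B : Set} (p : B → Bool) (f : A → B) (xs : List A) →
             countᵇ p (map f xs) ≡ countᵇ (p ∘ f) xs
countᵇ-map p f []       = refl
countᵇ-map p f (x ∷ xs) with p (f x)
... | true  = cong suc (countᵇ-map p f xs)
... | false = countᵇ-map p f xs

countᵇ-concatMap : {A B : Set} (p : B → Bool) (f : A → List B) (xs : List A) →
                   countᵇ p (concatMap f xs) ≡ sum (map (countᵇ p ∘ f) xs)
countᵇ-concatMap p f []       = refl
countᵇ-concatMap p f (x ∷ xs) =
  trans (countᵇ-++ p (f x) (concatMap f xs)) (cong (countᵇ p (f x) +_) (countᵇ-concatMap p f xs))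

countᵇ-none : {A : Set} {p : A → Bool} → (∀ x → p x ≡ false) → (xs : List A) → countᵇ p xs ≡ 0
countᵇ-none none []       = refl
countᵇ-none none (x ∷ xs) rewrite none x = countᵇ-none none xs

countᵇ-words-suc : ∀ (p : List ℕ → Bool) n k →
                   countᵇ p (words n (suc k)) ≡ ∑[ i < n ] countᵇ (λ w → p (suc i ∷ w)) (words n k)
countᵇ-words-suc p n k = begin
  countᵇ p (concatMap extend (map suc (upTo n)))
    ≡⟨ countᵇ-concatMap p extend (map suc (upTo n)) ⟩
  sum (map (countᵇ p ∘ extend) (map suc (upTo n)))
    ≡⟨ cong (sum ∘ map (countᵇ p ∘ extend)) (map-upTo suc n) ⟩
  sum (map (countᵇ p ∘ extend) (applyUpTo suc n))
    ≡⟨ cong sum (map-applyUpTo suc (countᵇ p ∘ extend) n) ⟩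
  sum (applyUpTo (countᵇ p ∘ extend ∘ suc) n)
    ≡⟨ sum-applyUpTo n _ ⟩
  ∑[ i < n ] countᵇ p (map (suc i ∷_) (words n k))
    ≡⟨ ∑-cong n (λ i _ → countᵇ-map p (suc i ∷_) (words n k)) ⟩
  ∑[ i < n ] countᵇ (λ w → p (suc i ∷ w)) (words n k)
    ∎
  where
  extend : ℕ → List (List ℕ)
  extend a = map (a ∷_) (words n k)

countᵇ-words-cong : ∀ {p q : List ℕ → Bool} n k → (∀ w → length w ≡ k → p w ≡ q w) →
                    countᵇ p (words n k) ≡ countᵇ q (words n k)
countᵇ-words-cong {p} {q} n zero eq with p [] | q [] | eq [] refl
... | true  | true  | refl = refl
... | false | false | refl = refl
countᵇ-words-cong {p} {q} n (suc k) eq = begin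
  countᵇ p (words n (suc k))                          ≡⟨ countᵇ-words-suc p n k ⟩
  ∑[ i < n ] countᵇ (λ w → p (suc i ∷ w)) (words n k) ≡⟨ ∑-cong n (λ i _ → countᵇ-words-cong n k (eq-∷ i)) ⟩
  ∑[ i < n ] countᵇ (λ w → q (suc i ∷ w)) (words n k) ≡⟨ countᵇ-words-suc q n k ⟨
  countᵇ q (words n (suc k))                          ∎
  where
  eq-∷ : ∀ i w → length w ≡ k → p (suc i ∷ w) ≡ q (suc i ∷ w)
  eq-∷ i w len = eq (suc i ∷ w) (cong suc len)

continuation : ℕ → List Bool → ℕ → List ℕ → Bool
continuation n s p w = ascending (p ∷ w) ∧ inRange n w ∧ allPark s w

countᵇ-continuation : ∀ n s p k → countᵇ (continuation n s p) (words n k) ≡ parkings n s p k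
countᵇ-continuation n s p zero    = refl
countᵇ-continuation n s p (suc k) = trans (countᵇ-words-suc (continuation n s p) n k) (∑-cong n first-car)
  where
  first-car : ∀ i → i < n →
              countᵇ (λ w → continuation n s p (suc i ∷ w)) (words n k) ≡ parkingsAt n s p k (suc i)
  first-car i i<n rewrite dec-true (suc i ≤? n) i<n with p ≤ᵇ suc i
  ... | false = countᵇ-none (λ _ → refl) (words n k)
  ... | true with naplesPark s (suc i)
  ...   | just s′ = countᵇ-continuation n s′ (suc i) k
  ...   | nothing = countᵇ-none (λ w → trans (cong (ascending (suc i ∷ w) ∧_) (∧-zeroʳ (inRange n w)))
                                              (∧-zeroʳ (ascending (suc i ∷ w))))
                                (words n k)

U1≡parkings : ∀ m → U1 (suc m) ≡ parkings (suc m) (filled 1 m) 1 m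
U1≡parkings m = begin
  countᵇ naples (words n n)
    ≡⟨ countᵇ-words-suc naples n m ⟩
  countᵇ (λ w → naples (1 ∷ w)) (words n m) +
  ∑[ i < m ] countᵇ (λ w → naples (2 + i ∷ w)) (words n m)
    ≡⟨ cong₂ _+_ (countᵇ-words-cong n m first-one)
                 (∑-zero m (λ i _ → countᵇ-none (not-one i) (words n m))) ⟩
  countᵇ (continuation n (filled 1 m) 1) (words n m) + 0
    ≡⟨ +-identityʳ _ ⟩
  countᵇ (continuation n (filled 1 m) 1) (words n m)
    ≡⟨ countᵇ-continuation n (filled 1 m) 1 m ⟩
  parkings n (filled 1 m) 1 m
    ∎
  where
  n = suc m
  naples : List ℕ → Bool
  naples a = ascending a ∧ firstIsOne a ∧ isNaplesPF n a
  first-one : ∀ w → length w ≡ m → naples (1 ∷ w) ≡ continuation n (filled 1 m) 1 w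
  first-one w len rewrite dec-true (length w ≟ m) len = refl
  not-one : ∀ i w → naples (2 + i ∷ w) ≡ false
  not-one i w = ∧-zeroʳ (ascending (2 + i ∷ w))

theorem5p4 : (n : ℕ) → U1 n ≡ fine (suc n)
theorem5p4 zero    = refl
theorem5p4 (suc m) = begin
  U1 (suc m)                        ≡⟨ U1≡parkings m ⟩
  parkings (suc m) (filled 1 m) 1 m ≡⟨ parkings-filled m 0 1 refl refl ⟩
  (ballot 2 ⋆ fine) m               ≡⟨ fine-suc-suc m ⟨
  fine (suc (suc m))                ∎
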